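{- Let $\alpha=(\alpha_1,\dots,\alpha_t)\in\mathcal{P}(n)$, and set $\alpha_{t+1}=0$. Write $\delta(\alpha)=\big(1,2,\dots,q,q^{(s_q)},(q-1)^{(s_{q-1})},\dots,1^{(s_1)}\big)$ with $q>0$, $s_i\ge0$, let $\overline{\alpha}=(\overline{\alpha}_1,\dots,\overline{\alpha}_q)$ with $\overline{\alpha}_i=q-i+1+\sum_{k=i}^q s_k$, and $\underline{\alpha}=\overline{\alpha}^*$. If $\alpha\neq\overline{\alpha}$, then $\alpha_i=\alpha_{i+1}$ for some $1\le i\le t$. Equivalently, if $\alpha\neq\underline{\alpha}$, then $\alpha_i-\alpha_{i+1}>1$ for some $1\le i\le t$.
   Context: $\mathcal{P}(n)$ is the set of partitions $\alpha=(\alpha_1\ge\dots\ge\alpha_t\ge1)$ of $n$. The diagonal sequence is $\delta(\alpha)=(d_k)_{k\ge1}$ with $d_k=\big|\{i:1\le i\le k,\ \alpha_i+i-1\ge k\}\big|$ (with $\alpha_i=0$ for $i>t$), trailing zeros omitted. The notation $m^{(s)}$ means $s$ consecutive entries equal to $m$. $\beta^*$ denotes the conjugate partition. -}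

module Defs where

open import Data.Nat using (ℕ; zero; suc; _+_; _∸_; _≤_; _≤?_; _≟_)
open import Data.List using (List; []; _∷_; map; length; filter; reverse; dropWhile; replicate; concat; _++_)
open import Data.Nat.ListAction using (sum)
open import Data.List.Relation.Unary.All using (All)
open import Data.List.Relation.Unary.Linked using (Linked)
open import Data.Product using (_×_)
open import Relation.Binary.PropositionalEquality using (_≡_)

IsPartition : ℕ → List ℕ → Set
IsPartition n α = Linked (λ a b → b ≤ a) α × All (1 ≤_) α × sum α ≡ n

-- 1-indexed entry, 0 beyond the length (α_i = 0 for i > t)
at : List ℕ → ℕ → ℕ
at []       _             = 0
at (x ∷ xs) zero          = 0   -- index 0 is unused
at (x ∷ xs) (suc zero)    = x
at (x ∷ xs) (suc (suc i)) = at xs (suc i)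

range : ℕ → ℕ → List ℕ
range a zero    = []
range a (suc m) = a ∷ range (suc a) m

oneTo : ℕ → List ℕ
oneTo m = range 1 m

diag : List ℕ → ℕ → ℕ
diag α k = length (filter (λ i → k ≤? at α i + i ∸ 1) (oneTo k))

dropTrailingZeros : List ℕ → List ℕ
dropTrailingZeros l = reverse (dropWhile (λ x → x ≟ 0) (reverse l))

-- δ(α) = (d_k)_{k ≥ 1} with trailing zeros omitted; d_k = 0 for k > |α|,
-- so it suffices to compute k = 1, ..., |α| (= n)
δ : List ℕ → List ℕ
δ α = dropTrailingZeros (map (diag α) (oneTo (sum α)))

tailBlocks : ℕ → (ℕ → ℕ) → List ℕ
tailBlocks zero    s = []
tailBlocks (suc j) s = replicate (s (suc j)) (suc j) ++ tailBlocks j s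

diagShape : ℕ → (ℕ → ℕ) → List ℕ
diagShape q s = oneTo q ++ tailBlocks q s

sumFromTo : ℕ → ℕ → (ℕ → ℕ) → ℕ
sumFromTo i q s = sum (map s (range i (suc q ∸ i)))

upperα : ℕ → (ℕ → ℕ) → List ℕ
upperα q s = map (λ i → (q ∸ i) + 1 + sumFromTo i q s) (oneTo q)

conj : List ℕ → List ℕ
conj β = map (λ j → length (filter (λ b → j ≤? b) β)) (oneTo (at β 1))

-- For a partition b with distinct parts and diagonal sequence (d_k), d_k ≥ i holds
-- exactly for i ≤ k ≤ b_i + i − 1, because the diagonal condition k ≤ b_i + i − 1 is
-- down-closed in i (b_i + i is weakly decreasing).  Hence b_i = #{k : d_k ≥ i}, while for
-- the shape (1, …, q, q^(s_q), …, 1^(s_1)) this count is ᾱ_i; so a partition with distinct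
-- parts is ᾱ.  If instead no two consecutive parts of α differ by more than one, the
-- conjugate α* has distinct parts; since δ(α) = δ(α*) (the diagonal condition is symmetric
-- under conjugation), α* = ᾱ and α = ᾱ*.
module Submission where

open import Level using (0ℓ)
open import Data.Nat using (ℕ; zero; suc; _+_; _∸_; _≤_; _<_; _≤?_; _<?_; _≟_; z≤n; s≤s)
open import Data.Nat.Properties
open import Data.Nat.ListAction using (sum)
open import Data.Nat.ListAction.Properties using (sum-++)
open import Data.List using (List; []; _∷_; [_]; _++_; length; map; filter; reverse; dropWhile; replicate)
open import Data.List.Properties
  using (length-++; length-map; length-replicate; length-filter; map-++; reverse-++;
         filter-++; filter-accept; filter-reject; filter-all; filter-none)
open import Data.List.Relation.Unary.All using (All; []; _∷_)
open import Data.List.Relation.Unary.All.Properties using (replicate⁺)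
open import Data.List.Relation.Unary.Linked using (Linked; _∷_)
open import Data.Product using (_×_; _,_; proj₁; proj₂; ∃-syntax)
open import Data.Sum using (inj₁; inj₂)
open import Function.Base using (_∘_)
open import Function.Bundles using (_⇔_; mk⇔; Equivalence)
open import Function.Properties.Equivalence using (⇔-setoid)
open import Relation.Binary.PropositionalEquality
  using (_≡_; refl; sym; trans; cong; cong₂; subst; module ≡-Reasoning)
open import Relation.Nullary using (¬_; yes; no; contradiction)
open import Relation.Nullary.Decidable using (decidable-stable)
open import Relation.Unary using (Decidable)
open import Relation.Binary.Bundles using (Setoid)
import Relation.Binary.Reasoning.Setoid as SetoidReasoning
open import Defs

open ≡-Reasoning
open SetoidReasoning (⇔-setoid 0ℓ) using (step-≈-⟩; step-≈-⟨)
  renaming (begin_ to ⇔-begin_; _∎ to _⇔-∎)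
open Equivalence using (to; from)
open Setoid (⇔-setoid 0ℓ) using () renaming (reflexive to ≡⇒⇔)

variable
  i k m n q t x y : ℕ
  s : ℕ → ℕ
  xs ys : List ℕ

-- Counting

count : {P : ℕ → Set} → Decidable P → List ℕ → ℕ
count P? xs = length (filter P? xs)

countTo : {P : ℕ → Set} → Decidable P → ℕ → ℕ
countTo P? n = count P? (oneTo n)

countAtLeast : ℕ → List ℕ → ℕ
countAtLeast i = count (i ≤?_)

DownClosedOn : (ℕ → Set) → ℕ → Set
DownClosedOn P n = ∀ {x y} → 1 ≤ x → x ≤ y → y ≤ n → P y → P x

module _ {P : ℕ → Set} (P? : Decidable P) where

  count-++ : ∀ xs ys → count P? (xs ++ ys) ≡ count P? xs + count P? ys
  count-++ xs ys = trans (cong length (filter-++ P? xs ys)) (length-++ (filter P? xs))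

  count-reverse : ∀ xs → count P? (reverse xs) ≡ count P? xs
  count-reverse []       = refl
  count-reverse (x ∷ xs) = begin
    count P? (reverse (x ∷ xs))            ≡⟨ cong (count P?) (reverse-++ [ x ] xs) ⟩
    count P? (reverse xs ++ [ x ])         ≡⟨ count-++ (reverse xs) [ x ] ⟩
    count P? (reverse xs) + count P? [ x ] ≡⟨ cong (_+ count P? [ x ]) (count-reverse xs) ⟩
    count P? xs + count P? [ x ]           ≡⟨ +-comm (count P? xs) _ ⟩
    count P? [ x ] + count P? xs           ≡⟨ count-++ [ x ] xs ⟨
    count P? (x ∷ xs)                      ∎

  count-map : (f : ℕ → ℕ) (xs : List ℕ) → count P? (map f xs) ≡ count (P? ∘ f) xs
  count-map f [] = refl
  count-map f (x ∷ xs) with P? (f x)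
  ... | yes _ = cong suc (count-map f xs)
  ... | no  _ = count-map f xs

  count-replicate-yes : (m : ℕ) → P x → count P? (replicate m x) ≡ m
  count-replicate-yes m p = trans (cong length (filter-all P? (replicate⁺ m p))) (length-replicate m)

  count-replicate-no : (m : ℕ) → ¬ P x → count P? (replicate m x) ≡ 0
  count-replicate-no m ¬p = cong length (filter-none P? (replicate⁺ m ¬p))

count-singleton-cong : {P Q : ℕ → Set} (P? : Decidable P) (Q? : Decidable Q) →
  (P x ⇔ Q x) → count P? [ x ] ≡ count Q? [ x ]
count-singleton-cong {x = x} P? Q? P⇔Q with P? x | Q? x
... | yes _ | yes _ = refl
... | no  _ | no  _ = refl
... | yes p | no ¬q = contradiction (to P⇔Q p) ¬q
... | no ¬p | yes q = contradiction (from P⇔Q q) ¬p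

range-snoc : ∀ a m → range a (suc m) ≡ range a m ++ [ a + m ]
range-snoc a zero    = cong [_] (sym (+-identityʳ a))
range-snoc a (suc m) = cong (a ∷_) (begin
  range (suc a) (suc m)          ≡⟨ range-snoc (suc a) m ⟩
  range (suc a) m ++ [ suc a + m ] ≡⟨ cong (λ z → range (suc a) m ++ [ z ]) (+-suc a m) ⟨
  range (suc a) m ++ [ a + suc m ] ∎)

length-range : ∀ a m → length (range a m) ≡ m
length-range a zero    = refl
length-range a (suc m) = cong suc (length-range (suc a) m)

map-range-suc : (f : ℕ → ℕ) → ∀ a m → map f (range (suc a) m) ≡ map (f ∘ suc) (range a m)
map-range-suc f a zero    = refl
map-range-suc f a (suc m) = cong (f (suc a) ∷_) (map-range-suc f (suc a) m)

reverse-oneTo : ∀ k → reverse (oneTo k) ≡ map (suc k ∸_) (oneTo k)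
reverse-oneTo zero    = refl
reverse-oneTo (suc k) = begin
  reverse (oneTo (suc k))          ≡⟨ cong reverse (range-snoc 1 k) ⟩
  reverse (oneTo k ++ [ suc k ])   ≡⟨ reverse-++ (oneTo k) [ suc k ] ⟩
  suc k ∷ reverse (oneTo k)        ≡⟨ cong (suc k ∷_) (reverse-oneTo k) ⟩
  suc k ∷ map (suc k ∸_) (oneTo k) ≡⟨ cong (suc k ∷_) (map-range-suc (suc (suc k) ∸_) 1 k) ⟨
  map (suc (suc k) ∸_) (oneTo (suc k)) ∎

length-map-oneTo : (f : ℕ → ℕ) → ∀ q → length (map f (oneTo q)) ≡ q
length-map-oneTo f q = trans (length-map f (oneTo q)) (length-range 1 q)

at-map-range : (f : ℕ → ℕ) → ∀ a m i → i < m → at (map f (range a m)) (suc i) ≡ f (a + i)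
at-map-range f a (suc m)       zero    _         = cong f (sym (+-identityʳ a))
at-map-range f a (suc (suc m)) (suc i) (s≤s i<m) =
  trans (at-map-range f (suc a) (suc m) i i<m) (cong f (sym (+-suc a i)))

at-map-oneTo : (f : ℕ → ℕ) → 1 ≤ i → i ≤ q → at (map f (oneTo q)) i ≡ f i
at-map-oneTo {suc i} {q} f _ i<q = at-map-range f 1 q i i<q

map-at-oneTo : ∀ xs → map (at xs) (oneTo (length xs)) ≡ xs
map-at-oneTo []       = refl
map-at-oneTo (x ∷ xs) = cong (x ∷_) (trans (shift 0 (length xs)) (map-at-oneTo xs))
  where
  shift : ∀ a m → map (at (x ∷ xs)) (range (2 + a) m) ≡ map (at xs) (range (1 + a) m)
  shift a zero    = refl
  shift a (suc m) = cong (at xs (suc a) ∷_) (shift (suc a) m)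

at-ext : length xs ≡ length ys → (∀ i → 1 ≤ i → i ≤ length xs → at xs i ≡ at ys i) →
         xs ≡ ys
at-ext {[]}     {[]}     _   _  = refl
at-ext {x ∷ xs} {y ∷ ys} len eq = cong₂ _∷_ (eq 1 ≤-refl (s≤s z≤n))
  (at-ext (suc-injective len) (λ { (suc i) _ i≤t → eq (suc (suc i)) (s≤s z≤n) (s≤s i≤t) }))

count-at : {P : ℕ → Set} (P? : Decidable P) → ∀ xs →
           count P? xs ≡ countTo (P? ∘ at xs) (length xs)
count-at P? xs = trans (cong (count P?) (sym (map-at-oneTo xs)))
                       (count-map P? (at xs) (oneTo (length xs)))

module _ {P : ℕ → Set} (P? : Decidable P) where

  countTo-suc : ∀ n → countTo P? (suc n) ≡ countTo P? n + count P? [ suc n ]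
  countTo-suc n = trans (cong (count P?) (range-snoc 1 n)) (count-++ P? (oneTo n) [ suc n ])

  countTo-suc-yes : P (suc n) → countTo P? (suc n) ≡ suc (countTo P? n)
  countTo-suc-yes {n} p = begin
    countTo P? (suc n)                 ≡⟨ countTo-suc n ⟩
    countTo P? n + count P? [ suc n ]  ≡⟨ cong (λ l → countTo P? n + length l) (filter-accept P? p) ⟩
    countTo P? n + 1                   ≡⟨ +-comm _ 1 ⟩
    suc (countTo P? n)                 ∎

  countTo-suc-no : ¬ P (suc n) → countTo P? (suc n) ≡ countTo P? n
  countTo-suc-no {n} ¬p = begin
    countTo P? (suc n)                 ≡⟨ countTo-suc n ⟩
    countTo P? n + count P? [ suc n ]  ≡⟨ cong (λ l → countTo P? n + length l) (filter-reject P? ¬p) ⟩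
    countTo P? n + 0                   ≡⟨ +-identityʳ _ ⟩
    countTo P? n                       ∎

  countTo-≤ : ∀ n → countTo P? n ≤ n
  countTo-≤ n = ≤-trans (length-filter P? (oneTo n)) (≤-reflexive (length-range 1 n))

  countTo-all : (∀ k → 1 ≤ k → k ≤ n → P k) → countTo P? n ≡ n
  countTo-all {zero}  _   = refl
  countTo-all {suc n} all = trans (countTo-suc-yes (all (suc n) (s≤s z≤n) ≤-refl))
    (cong suc (countTo-all (λ k 1≤k k≤n → all k 1≤k (m≤n⇒m≤1+n k≤n))))

  countTo-stable : m ≤ n → (∀ k → m < k → k ≤ n → ¬ P k) → countTo P? n ≡ countTo P? m
  countTo-stable {n = zero}  z≤n _ = refl
  countTo-stable {n = suc n} m≤1+n none with m≤n⇒m<n∨m≡n m≤1+n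
  ... | inj₂ refl  = refl
  ... | inj₁ m<1+n = trans (countTo-suc-no (none (suc n) m<1+n ≤-refl))
    (countTo-stable (≤-pred m<1+n) (λ k m<k k≤n → none k m<k (m≤n⇒m≤1+n k≤n)))

  countTo-≤⇔ : DownClosedOn P n → ∀ {r} → 1 ≤ r → (r ≤ countTo P? n ⇔ (r ≤ n × P r))
  countTo-≤⇔ {zero} _ {suc r} _ = mk⇔ (λ ()) (λ { (() , _) })
  countTo-≤⇔ {suc n} closed {r} 1≤r with P? (suc n)
  ... | yes p = mk⇔
    (λ r≤c → let r≤1+n = subst (r ≤_) full r≤c in r≤1+n , closed 1≤r r≤1+n ≤-refl p)
    (λ (r≤1+n , _) → subst (r ≤_) (sym full) r≤1+n)
    where
    full : countTo P? (suc n) ≡ suc n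
    full = countTo-all (λ k 1≤k k≤1+n → closed 1≤k k≤1+n ≤-refl p)
  ... | no ¬p = mk⇔
    (λ r≤c → let (r≤n , pr) = to ih (subst (r ≤_) (countTo-suc-no ¬p) r≤c)
             in  m≤n⇒m≤1+n r≤n , pr)
    (λ (r≤1+n , pr) → subst (r ≤_) (sym (countTo-suc-no ¬p))
      (from ih (≤-pred (≤∧≢⇒< r≤1+n λ { refl → ¬p pr }) , pr)))
    where
    ih : r ≤ countTo P? n ⇔ (r ≤ n × P r)
    ih = countTo-≤⇔ (λ 1≤x x≤y y≤n → closed 1≤x x≤y (m≤n⇒m≤1+n y≤n)) 1≤r

  countTo-reflect : ∀ k → countTo P? k ≡ countTo (P? ∘ (suc k ∸_)) k
  countTo-reflect k = begin
    count P? (oneTo k)                  ≡⟨ count-reverse P? (oneTo k) ⟨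
    count P? (reverse (oneTo k))        ≡⟨ cong (count P?) (reverse-oneTo k) ⟩
    count P? (map (suc k ∸_) (oneTo k)) ≡⟨ count-map P? (suc k ∸_) (oneTo k) ⟩
    countTo (P? ∘ (suc k ∸_)) k         ∎

countTo-cong : {P Q : ℕ → Set} (P? : Decidable P) (Q? : Decidable Q) →
  (∀ k → 1 ≤ k → k ≤ n → P k ⇔ Q k) → countTo P? n ≡ countTo Q? n
countTo-cong {zero}  P? Q? _     = refl
countTo-cong {suc n} P? Q? equiv = begin
  countTo P? (suc n)                ≡⟨ countTo-suc P? n ⟩
  countTo P? n + count P? [ suc n ] ≡⟨ cong₂ _+_ (countTo-cong P? Q? restricted)
                                        (count-singleton-cong P? Q? (equiv (suc n) (s≤s z≤n) ≤-refl)) ⟩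
  countTo Q? n + count Q? [ suc n ] ≡⟨ countTo-suc Q? n ⟨
  countTo Q? (suc n)                ∎
  where
  restricted = λ k 1≤k k≤n → equiv k 1≤k (m≤n⇒m≤1+n k≤n)

countTo-atLeast : 1 ≤ i → ∀ n → countTo (i ≤?_) n ≡ suc n ∸ i
countTo-atLeast {suc i} _ zero = sym (0∸n≡0 i)
countTo-atLeast {i} 1≤i (suc n) with i ≤? suc n
... | yes i≤1+n = begin
  countTo (i ≤?_) (suc n) ≡⟨ countTo-suc-yes (i ≤?_) i≤1+n ⟩
  suc (countTo (i ≤?_) n) ≡⟨ cong suc (countTo-atLeast 1≤i n) ⟩
  suc (suc n ∸ i)         ≡⟨ +-∸-assoc 1 i≤1+n ⟨
  suc (suc n) ∸ i         ∎
... | no i≰1+n = begin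
  countTo (i ≤?_) (suc n) ≡⟨ countTo-suc-no (i ≤?_) i≰1+n ⟩
  countTo (i ≤?_) n       ≡⟨ countTo-atLeast 1≤i n ⟩
  suc n ∸ i               ≡⟨ m≤n⇒m∸n≡0 (<⇒≤ (≰⇒> i≰1+n)) ⟩
  0                       ≡⟨ m≤n⇒m∸n≡0 (≰⇒> i≰1+n) ⟨
  suc (suc n) ∸ i         ∎

countTo-atMost : ∀ {c} → c ≤ n → countTo (_≤? c) n ≡ c
countTo-atMost {c = c} c≤n = trans (countTo-stable (_≤? c) c≤n (λ k c<k _ k≤c → <⇒≱ c<k k≤c))
                                   (countTo-all (_≤? c) (λ _ _ k≤c → k≤c))

support-≤ : {f : ℕ → ℕ} → (∀ i → 1 ≤ i → i ≤ m → 1 ≤ f i) → (∀ i → n < i → f i ≡ 0) →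
            m ≤ n
support-≤ {zero}      _   _      = z≤n
support-≤ {suc m} {n} pos vanish with suc m ≤? n
... | yes 1+m≤n = 1+m≤n
... | no  1+m≰n =
  contradiction (sym (vanish (suc m) (≰⇒> 1+m≰n))) (<⇒≢ (pos (suc m) (s≤s z≤n) ≤-refl))

m≤n+o∸1⇔1+m∸o≤n : ∀ m n o → 1 ≤ o → (m ≤ n + o ∸ 1) ⇔ (suc m ∸ o ≤ n)
m≤n+o∸1⇔1+m∸o≤n m n (suc o) _ rewrite +-∸-assoc n (s≤s (z≤n {o})) = mk⇔
  (λ m≤n+o → m≤n+o⇒m∸n≤o m o (subst (m ≤_) (+-comm n o) m≤n+o))
  (λ m∸o≤n → subst (m ≤_) (+-comm o n) (≤-trans (m≤n+m∸n m o) (+-monoʳ-≤ o m∸o≤n)))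

at-beyond : ∀ xs → length xs < i → at xs i ≡ 0
at-beyond []       _         = refl
at-beyond {suc (suc i)} (x ∷ xs) (s≤s l<i) = at-beyond xs l<i

at-positive⇒≤length : ∀ xs → 1 ≤ at xs i → i ≤ length xs
at-positive⇒≤length {suc zero}    (x ∷ xs) _   = s≤s z≤n
at-positive⇒≤length {suc (suc i)} (x ∷ xs) pos = s≤s (at-positive⇒≤length xs pos)

at-positive : All (1 ≤_) xs → 1 ≤ i → i ≤ length xs → 1 ≤ at xs i
at-positive {i = suc zero}    (p ∷ _)  _ _         = p
at-positive {i = suc (suc i)} (_ ∷ ps) _ (s≤s i<t) = at-positive ps (s≤s z≤n) i<t

at-suc-≤ : Linked (λ a b → b ≤ a) xs → 1 ≤ i → at xs (suc i) ≤ at xs i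
at-suc-≤ {[]}                        _            _ = z≤n
at-suc-≤ {_ ∷ []}    {suc _}         _            _ = z≤n
at-suc-≤ {_ ∷ _ ∷ _} {suc zero}      (y≤x ∷ _)    _ = y≤x
at-suc-≤ {_ ∷ _ ∷ _} {suc (suc i)}   (_ ∷ linked) _ = at-suc-≤ linked (s≤s z≤n)

at-antitone : Linked (λ a b → b ≤ a) xs → 1 ≤ x → x ≤ y → at xs y ≤ at xs x
at-antitone {y = zero} _ 1≤x x≤0 = contradiction (≤-trans 1≤x x≤0) λ ()
at-antitone {y = suc y} dec 1≤x x≤1+y with m≤n⇒m<n∨m≡n x≤1+y
... | inj₂ refl      = ≤-refl
... | inj₁ (s≤s x≤y) = ≤-trans (at-suc-≤ dec (≤-trans 1≤x x≤y)) (at-antitone dec 1≤x x≤y)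

length≤sum : All (1 ≤_) xs → length xs ≤ sum xs
length≤sum []       = z≤n
length≤sum (p ∷ ps) = +-mono-≤ p (length≤sum ps)

head≤sum : ∀ xs → at xs 1 ≤ sum xs
head≤sum []       = z≤n
head≤sum (x ∷ xs) = m≤m+n x (sum xs)

-- Diagonal sequences

-- diag α k and diagOf (at α) k are definitionally equal.
diagOf : (ℕ → ℕ) → ℕ → ℕ
diagOf b k = countTo (λ i → k ≤? b i + i ∸ 1) k

AreConjugate : (ℕ → ℕ) → (ℕ → ℕ) → Set
AreConjugate a b = ∀ {i j} → 1 ≤ i → 1 ≤ j → (j ≤ b i ⇔ i ≤ a j)

diagOf-conjugate : {a b : ℕ → ℕ} → AreConjugate a b → ∀ k → diagOf a k ≡ diagOf b k
diagOf-conjugate {a} {b} conjugate k = begin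
  diagOf a k
    ≡⟨ countTo-reflect (λ r → k ≤? a r + r ∸ 1) k ⟩
  countTo (λ j → k ≤? a (suc k ∸ j) + (suc k ∸ j) ∸ 1) k
    ≡⟨ countTo-cong _ _ reflected ⟩
  diagOf b k ∎
  where
  reflected : ∀ j → 1 ≤ j → j ≤ k →
              (k ≤ a (suc k ∸ j) + (suc k ∸ j) ∸ 1) ⇔ (k ≤ b j + j ∸ 1)
  reflected j 1≤j j≤k = ⇔-begin
    k ≤ a r + r ∸ 1 ≈⟨ m≤n+o∸1⇔1+m∸o≤n k (a r) r 1≤r ⟩
    suc k ∸ r ≤ a r ≈⟨ ≡⇒⇔ (cong (_≤ a r) (m∸[m∸n]≡n (m≤n⇒m≤1+n j≤k))) ⟩
    j ≤ a r         ≈⟨ conjugate 1≤j 1≤r ⟨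
    r ≤ b j         ≈⟨ m≤n+o∸1⇔1+m∸o≤n k (b j) j 1≤j ⟨
    k ≤ b j + j ∸ 1 ⇔-∎
    where
    r = suc k ∸ j
    1≤r : 1 ≤ r
    1≤r = m<n⇒0<n∸m (s≤s j≤k)

record IsStrictPartition (b : ℕ → ℕ) (t : ℕ) : Set where
  field
    decreasing : ∀ i → 1 ≤ i → i < t → b (suc i) < b i
    positive   : ∀ i → 1 ≤ i → i ≤ t → 1 ≤ b i
    vanishing  : ∀ i → t < i → b i ≡ 0

module StrictDiagonal {b : ℕ → ℕ} {t : ℕ} (strict : IsStrictPartition b t) where
  open IsStrictPartition strict

  +-antitone : 1 ≤ x → x ≤ y → y ≤ t → b y + y ≤ b x + x
  +-antitone {y = zero}  1≤x x≤0 _ = contradiction (≤-trans 1≤x x≤0) λ ()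
  +-antitone {y = suc y} 1≤x x≤1+y 1+y≤t with m≤n⇒m<n∨m≡n x≤1+y
  ... | inj₂ refl      = ≤-refl
  ... | inj₁ (s≤s x≤y) = ≤-trans (≤-reflexive (+-suc (b (suc y)) y))
    (≤-trans (+-monoˡ-≤ y (decreasing y (≤-trans 1≤x x≤y) 1+y≤t))
             (+-antitone 1≤x x≤y (<⇒≤ 1+y≤t)))

  beyond-diagonal : t < y → y ≤ k → ¬ (k ≤ b y + y ∸ 1)
  beyond-diagonal {suc y} {k} t<y y≤k k≤ =
    1+n≰n (≤-trans y≤k (subst (λ z → k ≤ z + suc y ∸ 1) (vanishing (suc y) t<y) k≤))

  diagonal-downClosed : ∀ k → DownClosedOn (λ i → k ≤ b i + i ∸ 1) k
  diagonal-downClosed k {x} {y} 1≤x x≤y y≤k k≤ with y ≤? t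
  ... | yes y≤t = ≤-trans k≤ (∸-monoˡ-≤ 1 (+-antitone 1≤x x≤y y≤t))
  ... | no  y≰t = contradiction k≤ (beyond-diagonal (≰⇒> y≰t) y≤k)

  ≤diagOf⇔ : 1 ≤ i → (i ≤ diagOf b k ⇔ (i ≤ k × k ≤ b i + i ∸ 1))
  ≤diagOf⇔ {k = k} = countTo-≤⇔ (λ i → k ≤? b i + i ∸ 1) (diagonal-downClosed k)

  diagOf-head-bound : 1 ≤ i → i ≤ t → b i + i ∸ 1 ≤ b 1
  diagOf-head-bound 1≤i i≤t =
    ≤-trans (∸-monoˡ-≤ 1 (+-antitone ≤-refl 1≤i i≤t)) (≤-reflexive (m+n∸n≡m (b 1) 1))

  countTo-≤diagOf : 1 ≤ i → b i + i ∸ 1 ≤ n → countTo (λ k → i ≤? diagOf b k) n ≡ b i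
  countTo-≤diagOf {suc i} {n} 1≤i E≤n = begin
    countTo (λ k → suc i ≤? diagOf b k) n ≡⟨ countTo-stable _ E≤n outside ⟩
    countTo (λ k → suc i ≤? diagOf b k) E ≡⟨ countTo-cong _ _ inside ⟩
    countTo (suc i ≤?_) E                 ≡⟨ countTo-atLeast 1≤i E ⟩
    suc E ∸ suc i                         ≡⟨ cong (_∸ i) (+-∸-assoc (b (suc i)) 1≤i) ⟩
    b (suc i) + i ∸ i                     ≡⟨ m+n∸n≡m (b (suc i)) i ⟩
    b (suc i)                             ∎
    where
    E = b (suc i) + suc i ∸ 1
    outside : ∀ k → E < k → k ≤ n → ¬ (suc i ≤ diagOf b k)
    outside k E<k _ i≤d = <⇒≱ E<k (proj₂ (to (≤diagOf⇔ 1≤i) i≤d))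
    inside : ∀ k → 1 ≤ k → k ≤ E → (suc i ≤ diagOf b k) ⇔ (suc i ≤ k)
    inside k _ k≤E = mk⇔ (proj₁ ∘ to (≤diagOf⇔ 1≤i))
                         (λ i≤k → from (≤diagOf⇔ 1≤i) (i≤k , k≤E))

  countTo-≤diagOf-vanishing : t < i → countTo (λ k → i ≤? diagOf b k) n ≡ 0
  countTo-≤diagOf-vanishing {i} {n} t<i =
    countTo-stable (λ k → i ≤? diagOf b k) {n = n} z≤n λ k _ _ i≤d →
      let (i≤k , k≤) = to (≤diagOf⇔ {k = k} (≤-trans (s≤s z≤n) t<i)) i≤d
      in  beyond-diagonal t<i i≤k k≤

countAtLeast-dropZeros : 1 ≤ i → ∀ xs → countAtLeast i (dropWhile (_≟ 0) xs) ≡ countAtLeast i xs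
countAtLeast-dropZeros {suc i} _   []           = refl
countAtLeast-dropZeros {suc i} 1≤i (zero  ∷ xs) = countAtLeast-dropZeros 1≤i xs
countAtLeast-dropZeros {suc i} _   (suc _ ∷ _)  = refl

countAtLeast-δ : 1 ≤ i → ∀ α → countAtLeast i (δ α) ≡ countTo (λ k → i ≤? diag α k) (sum α)
countAtLeast-δ {i} 1≤i α = begin
  countAtLeast i (reverse (dropWhile (_≟ 0) (reverse ds)))
    ≡⟨ count-reverse (i ≤?_) (dropWhile (_≟ 0) (reverse ds)) ⟩
  countAtLeast i (dropWhile (_≟ 0) (reverse ds))
    ≡⟨ countAtLeast-dropZeros 1≤i (reverse ds) ⟩
  countAtLeast i (reverse ds)
    ≡⟨ count-reverse (i ≤?_) ds ⟩
  countAtLeast i ds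
    ≡⟨ count-map (i ≤?_) (diag α) (oneTo (sum α)) ⟩
  countTo (λ k → i ≤? diag α k) (sum α) ∎
  where
  ds = map (diag α) (oneTo (sum α))

sumFromTo-vanishing : q < i → sumFromTo i q s ≡ 0
sumFromTo-vanishing {i = i} {s} q<i = cong (λ l → sum (map s (range i l))) (m≤n⇒m∸n≡0 q<i)

sumFromTo-suc : i ≤ suc q → sumFromTo i (suc q) s ≡ s (suc q) + sumFromTo i q s
sumFromTo-suc {i} {q} {s} i≤1+q = begin
  sum (map s (range i (suc (suc q) ∸ i))) ≡⟨ cong (sum ∘ map s ∘ range i) (+-∸-assoc 1 i≤1+q) ⟩
  sum (map s (range i (suc l)))           ≡⟨ cong (sum ∘ map s) (range-snoc i l) ⟩
  sum (map s (range i l ++ [ i + l ]))    ≡⟨ cong sum (map-++ s (range i l) [ i + l ]) ⟩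
  sum (map s (range i l) ++ [ s (i + l) ]) ≡⟨ sum-++ (map s (range i l)) [ s (i + l) ] ⟩
  sumFromTo i q s + (s (i + l) + 0)       ≡⟨ cong (sumFromTo i q s +_) (+-identityʳ _) ⟩
  sumFromTo i q s + s (i + l)             ≡⟨ cong (λ z → sumFromTo i q s + s z) (m+[n∸m]≡n i≤1+q) ⟩
  sumFromTo i q s + s (suc q)             ≡⟨ +-comm (sumFromTo i q s) _ ⟩
  s (suc q) + sumFromTo i q s             ∎
  where
  l = suc q ∸ i

countAtLeast-tailBlocks : 1 ≤ i → ∀ q → countAtLeast i (tailBlocks q s) ≡ sumFromTo i q s
countAtLeast-tailBlocks 1≤i zero = sym (sumFromTo-vanishing 1≤i)
countAtLeast-tailBlocks {i} {s} 1≤i (suc q) with i ≤? suc q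
... | yes i≤1+q = begin
  countAtLeast i (replicate (s (suc q)) (suc q) ++ tailBlocks q s)
    ≡⟨ count-++ (i ≤?_) (replicate (s (suc q)) (suc q)) (tailBlocks q s) ⟩
  countAtLeast i (replicate (s (suc q)) (suc q)) + countAtLeast i (tailBlocks q s)
    ≡⟨ cong₂ _+_ (count-replicate-yes (i ≤?_) (s (suc q)) i≤1+q) (countAtLeast-tailBlocks 1≤i q) ⟩
  s (suc q) + sumFromTo i q s
    ≡⟨ sumFromTo-suc i≤1+q ⟨
  sumFromTo i (suc q) s ∎
... | no i≰1+q = begin
  countAtLeast i (replicate (s (suc q)) (suc q) ++ tailBlocks q s)
    ≡⟨ count-++ (i ≤?_) (replicate (s (suc q)) (suc q)) (tailBlocks q s) ⟩
  countAtLeast i (replicate (s (suc q)) (suc q)) + countAtLeast i (tailBlocks q s)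
    ≡⟨ cong₂ _+_ (count-replicate-no (i ≤?_) (s (suc q)) i≰1+q) (countAtLeast-tailBlocks 1≤i q) ⟩
  sumFromTo i q s
    ≡⟨ sumFromTo-vanishing (<⇒≤ (≰⇒> i≰1+q)) ⟩
  0
    ≡⟨ sumFromTo-vanishing (≰⇒> i≰1+q) ⟨
  sumFromTo i (suc q) s ∎

countAtLeast-diagShape : 1 ≤ i → countAtLeast i (diagShape q s) ≡ suc q ∸ i + sumFromTo i q s
countAtLeast-diagShape {i} {q} {s} 1≤i = trans (count-++ (i ≤?_) (oneTo q) (tailBlocks q s))
  (cong₂ _+_ (countTo-atLeast 1≤i q) (countAtLeast-tailBlocks 1≤i q))

at-upperα : 1 ≤ i → i ≤ q → at (upperα q s) i ≡ suc q ∸ i + sumFromTo i q s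
at-upperα {i} {q} {s} 1≤i i≤q = begin
  at (upperα q s) i                 ≡⟨ at-map-oneTo _ 1≤i i≤q ⟩
  q ∸ i + 1 + sumFromTo i q s       ≡⟨ cong (_+ sumFromTo i q s) (+-comm (q ∸ i) 1) ⟩
  suc (q ∸ i) + sumFromTo i q s     ≡⟨ cong (_+ sumFromTo i q s) (+-∸-assoc 1 i≤q) ⟨
  suc q ∸ i + sumFromTo i q s       ∎

-- Partitions with distinct parts are determined by δ

upperα-from-diagonal : ∀ α q s → δ α ≡ diagShape q s →
  {b : ℕ → ℕ} {t : ℕ} → IsStrictPartition b t → b 1 ≤ sum α →
  (∀ k → diag α k ≡ diagOf b k) →
  q ≡ t × (∀ i → 1 ≤ i → i ≤ q → at (upperα q s) i ≡ b i)
upperα-from-diagonal α q s δα≡ {b} {t} strict b₁≤sum diag≡ =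
  q≡t , λ i 1≤i i≤q → begin
    at (upperα q s) i           ≡⟨ at-upperα 1≤i i≤q ⟩
    suc q ∸ i + sumFromTo i q s ≡⟨ c-shape 1≤i ⟨
    c i                         ≡⟨ c-strict 1≤i (subst (i ≤_) q≡t i≤q) ⟩
    b i                         ∎
  where
  open IsStrictPartition strict
  open StrictDiagonal strict

  -- c i = #{k : d_k ≥ i}, read off once from the shape and once from b.
  c : ℕ → ℕ
  c i = countTo (λ k → i ≤? diag α k) (sum α)

  c-shape : 1 ≤ i → c i ≡ suc q ∸ i + sumFromTo i q s
  c-shape {i} 1≤i = begin
    c i                            ≡⟨ countAtLeast-δ 1≤i α ⟨
    countAtLeast i (δ α)           ≡⟨ cong (countAtLeast i) δα≡ ⟩
    countAtLeast i (diagShape q s) ≡⟨ countAtLeast-diagShape 1≤i ⟩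
    suc q ∸ i + sumFromTo i q s    ∎

  c-diagOf : c i ≡ countTo (λ k → i ≤? diagOf b k) (sum α)
  c-diagOf {i} = countTo-cong {sum α} _ _ λ k _ _ →
    mk⇔ (subst (i ≤_) (diag≡ k)) (subst (i ≤_) (sym (diag≡ k)))

  c-strict : 1 ≤ i → i ≤ t → c i ≡ b i
  c-strict 1≤i i≤t =
    trans c-diagOf (countTo-≤diagOf 1≤i (≤-trans (diagOf-head-bound 1≤i i≤t) b₁≤sum))

  q≡t : q ≡ t
  q≡t = ≤-antisym (support-≤ positive-to-q vanishing-after-t)
                  (support-≤ positive-to-t vanishing-after-q)
    where
    positive-to-q : ∀ i → 1 ≤ i → i ≤ q → 1 ≤ c i
    positive-to-q i 1≤i i≤q =
      subst (1 ≤_) (sym (c-shape 1≤i)) (≤-trans (m<n⇒0<n∸m (s≤s i≤q)) (m≤m+n _ _))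
    vanishing-after-q : ∀ i → q < i → c i ≡ 0
    vanishing-after-q i q<i = trans (c-shape (≤-trans (s≤s z≤n) q<i))
      (cong₂ _+_ (m≤n⇒m∸n≡0 q<i) (sumFromTo-vanishing q<i))
    positive-to-t : ∀ i → 1 ≤ i → i ≤ t → 1 ≤ c i
    positive-to-t i 1≤i i≤t = subst (1 ≤_) (sym (c-strict 1≤i i≤t)) (positive i 1≤i i≤t)
    vanishing-after-t : ∀ i → t < i → c i ≡ 0
    vanishing-after-t i t<i = trans c-diagOf (countTo-≤diagOf-vanishing {n = sum α} t<i)

distinctParts⇒upperα : ∀ {n α q s} → IsPartition n α → δ α ≡ diagShape q s →
  (∀ i → 1 ≤ i → i ≤ length α → ¬ at α i ≡ at α (i + 1)) → α ≡ upperα q s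
distinctParts⇒upperα {α = α} {q} {s} (decreasing , positive , _) δα≡ distinct =
  at-ext (sym (trans (length-map-oneTo _ q) q≡t))
    (λ i 1≤i i≤t → sym (proj₂ reconstruction i 1≤i (subst (i ≤_) (sym q≡t) i≤t)))
  where
  strict : IsStrictPartition (at α) (length α)
  strict = record
    { decreasing = λ i 1≤i i<t → ≤∧≢⇒< (at-suc-≤ decreasing 1≤i)
        λ eq → distinct i 1≤i (<⇒≤ i<t) (trans (sym eq) (cong (at α) (+-comm 1 i)))
    ; positive   = λ i → at-positive positive
    ; vanishing  = λ i → at-beyond α
    }
  reconstruction = upperα-from-diagonal α q s δα≡ strict (head≤sum α) (λ k → refl)
  q≡t = proj₁ reconstruction

module ConjugatePartition {n : ℕ} {α : List ℕ} (partition : IsPartition n α) where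
  private
    decreasing = proj₁ partition
    positive   = proj₁ (proj₂ partition)

  conjugate : ℕ → ℕ
  conjugate j = countTo (λ i → j ≤? at α i) (length α)

  at-conjugate : AreConjugate (at α) conjugate
  at-conjugate {j} {r} 1≤j 1≤r = mk⇔ (proj₂ ∘ to counted)
    (λ j≤αr → from counted (at-positive⇒≤length α (≤-trans 1≤j j≤αr) , j≤αr))
    where
    counted = countTo-≤⇔ (λ i → j ≤? at α i)
      (λ 1≤x x≤y _ j≤αy → ≤-trans j≤αy (at-antitone decreasing 1≤x x≤y)) 1≤r

  conjugate-head : conjugate 1 ≡ length α
  conjugate-head = countTo-all _ {length α} (λ i 1≤i i≤t → at-positive positive 1≤i i≤t)

  conjugate-isStrictPartition : (∀ i → 1 ≤ i → i ≤ length α → at α i ≤ suc (at α (suc i))) →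
    IsStrictPartition conjugate (at α 1)
  conjugate-isStrictPartition noGap = record
    { decreasing = λ j 1≤j j<m →
        from (at-conjugate 1≤j (s≤s z≤n)) (below j j<m (conjugate (suc j)) ≤-refl)
    ; positive   = λ j 1≤j j≤m → from (at-conjugate 1≤j ≤-refl) j≤m
    ; vanishing  = λ j m<j → countTo-stable _ {n = length α} z≤n λ i 1≤i _ j≤αi →
        <⇒≱ m<j (≤-trans j≤αi (at-antitone decreasing ≤-refl 1≤i))
    }
    where
    -- a part ≥ j + 1 that is not followed by a gap is followed by a part ≥ j
    below : ∀ j → j < at α 1 → ∀ p → p ≤ conjugate (suc j) → j ≤ at α (suc p)
    below j j<m zero    _      = <⇒≤ j<m
    below j _   (suc p) 1+p≤b′ = ≤-pred (≤-trans
      (to (at-conjugate (s≤s z≤n) (s≤s z≤n)) 1+p≤b′)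
      (noGap (suc p) (s≤s z≤n) (≤-trans 1+p≤b′ (countTo-≤ _ _))))

noGaps⇒conj-upperα : ∀ {n α q s} → IsPartition n α → 0 < q → δ α ≡ diagShape q s →
  (∀ i → 1 ≤ i → i ≤ length α → ¬ at α (i + 1) + 1 < at α i) → α ≡ conj (upperα q s)
noGaps⇒conj-upperα {α = α} {q} {s} partition@(decreasing , positive , _) 0<q δα≡ noGap =
  at-ext (sym length-conj) entries
  where
  open ConjugatePartition partition

  ᾱ = upperα q s

  reconstruction = upperα-from-diagonal α q s δα≡ (conjugate-isStrictPartition noGap′)
    (subst (_≤ sum α) (sym conjugate-head) (length≤sum positive)) (diagOf-conjugate at-conjugate)
    where
    noGap′ : ∀ i → 1 ≤ i → i ≤ length α → at α i ≤ suc (at α (suc i))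
    noGap′ i 1≤i i≤t = subst (at α i ≤_) (trans (+-comm _ 1) (cong (suc ∘ at α) (+-comm i 1)))
      (≮⇒≥ (noGap i 1≤i i≤t))
  q≡α₁ = proj₁ reconstruction
  ᾱ≡conjugate = proj₂ reconstruction

  ᾱ₁≡t : at ᾱ 1 ≡ length α
  ᾱ₁≡t = trans (ᾱ≡conjugate 1 ≤-refl 0<q) conjugate-head

  length-conj : length (conj ᾱ) ≡ length α
  length-conj = trans (length-map-oneTo _ (at ᾱ 1)) ᾱ₁≡t

  entries : ∀ j → 1 ≤ j → j ≤ length α → at α j ≡ at (conj ᾱ) j
  entries j 1≤j j≤t = sym (begin
    at (conj ᾱ) j                          ≡⟨ at-map-oneTo _ 1≤j (subst (j ≤_) (sym ᾱ₁≡t) j≤t) ⟩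
    countAtLeast j ᾱ                       ≡⟨ count-at (j ≤?_) ᾱ ⟩
    countTo (λ i → j ≤? at ᾱ i) (length ᾱ) ≡⟨ cong (countTo _) (length-map-oneTo _ q) ⟩
    countTo (λ i → j ≤? at ᾱ i) q          ≡⟨ countTo-cong _ _ transposed ⟩
    countTo (_≤? at α j) q                 ≡⟨ countTo-atMost αⱼ≤q ⟩
    at α j                                 ∎)
    where
    transposed : ∀ i → 1 ≤ i → i ≤ q → (j ≤ at ᾱ i) ⇔ (i ≤ at α j)
    transposed i 1≤i i≤q = ⇔-begin
      j ≤ at ᾱ i       ≈⟨ ≡⇒⇔ (cong (j ≤_) (ᾱ≡conjugate i 1≤i i≤q)) ⟩
      j ≤ conjugate i  ≈⟨ at-conjugate 1≤i 1≤j ⟩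
      i ≤ at α j       ⇔-∎
    αⱼ≤q : at α j ≤ q
    αⱼ≤q = subst (at α j ≤_) (sym q≡α₁) (at-antitone decreasing ≤-refl 1≤j)

bounded-witness : {P : ℕ → Set} → Decidable P → ∀ n →
  ¬ (∀ i → 1 ≤ i → i ≤ n → ¬ P i) → ∃[ i ] (1 ≤ i × i ≤ n × P i)
bounded-witness P? n noCounterexample
  with (j , j<n , p) ← decidable-stable (anyUpTo? (P? ∘ suc) n)
         (λ none → noCounterexample λ { (suc j) _ j<n p → none (j , j<n , p) })
  = suc j , s≤s z≤n , j<n , p

corollary2p7 : (n : ℕ) (α : List ℕ) → IsPartition n α →
    (q : ℕ) (s : ℕ → ℕ) → 0 < q → δ α ≡ diagShape q s →
    ((¬ (α ≡ upperα q s)) →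
       ∃[ i ] (1 ≤ i × i ≤ length α × at α i ≡ at α (i + 1)))
    × ((¬ (α ≡ conj (upperα q s))) →
       ∃[ i ] (1 ≤ i × i ≤ length α × at α (i + 1) + 1 < at α i))
corollary2p7 n α partition q s 0<q δα≡ =
    (λ α≢ᾱ → bounded-witness (λ i → at α i ≟ at α (i + 1)) (length α)
                (α≢ᾱ ∘ distinctParts⇒upperα partition δα≡))
  , (λ α≢ᾱ* → bounded-witness (λ i → at α (i + 1) + 1 <? at α i) (length α)
                (α≢ᾱ* ∘ noGaps⇒conj-upperα partition 0<q δα≡))
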